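{- Let $n\geq 3$ and let $G$ be the graph with vertex set $A\cup B$, $A=\{a_1,\dots,a_n\}$, $B=\{b_1,\dots,b_n\}$ disjoint, such that $G[A]$ and $G[B]$ are cliques and, for $a_i\in A$, $b_j\in B$, $a_ib_j\in E(G)$ if and only if $i=j$. Then for every $2$-subcoloring $\mu:V(G)\to\{0,1\}$ of $G$, we have $\mu(a_i)\neq\mu(b_i)$ for all $1\leq i\leq n$.
   Context: A $k$-subcoloring of a graph is a map $\mu:V(G)\to\{$k colors$\}$ such that each color class induces a disjoint union of cliques, i.e. contains no induced path on three vertices. -}

module Defs where

open import Data.Nat using (ℕ)
open import Data.Fin using (Fin)
open import Data.Sum using (_⊎_; inj₁; inj₂)
open import Data.Product using (_×_)
open import Data.Empty using (⊥)
open import Relation.Nullary using (¬_)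
open import Relation.Binary.PropositionalEquality using (_≡_; _≢_)
open import Level using (0ℓ)

record Graph (V : Set) : Set₁ where
  field
    Adj   : V → V → Set
    sym   : ∀ {x y} → Adj x y → Adj y x
    irrefl : ∀ {x} → ¬ Adj x x
open Graph public

InducedP3 : {V : Set} → Graph V → V → V → V → Set
InducedP3 G x y z = Adj G x y × Adj G y z × x ≢ z × ¬ Adj G x z

IsSubcoloring : {V : Set} (G : Graph V) (k : ℕ) → (V → Fin k) → Set
IsSubcoloring G k μ =
  ∀ x y z → μ x ≡ μ y → μ y ≡ μ z → ¬ InducedP3 G x y z

-- The graph of the lemma: vertices inj₁ i = a_i, inj₂ j = b_j.
-- A and B are cliques; a_i b_j is an edge iff i = j.
ABAdj : (n : ℕ) → Fin n ⊎ Fin n → Fin n ⊎ Fin n → Set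
ABAdj n (inj₁ i) (inj₁ j) = i ≢ j
ABAdj n (inj₂ i) (inj₂ j) = i ≢ j
ABAdj n (inj₁ i) (inj₂ j) = i ≡ j
ABAdj n (inj₂ i) (inj₁ j) = i ≡ j

ABGraph : (n : ℕ) → Graph (Fin n ⊎ Fin n)
ABGraph n = record { Adj = ABAdj n ; sym = s ; irrefl = ir }
  where
  open import Relation.Binary.PropositionalEquality using (refl) renaming (sym to ≡sym)
  s : ∀ {x y} → ABAdj n x y → ABAdj n y x
  s {inj₁ i} {inj₁ j} p q = p (≡sym q)
  s {inj₂ i} {inj₂ j} p q = p (≡sym q)
  s {inj₁ i} {inj₂ j} p = ≡sym p
  s {inj₂ i} {inj₁ j} p = ≡sym p
  ir : ∀ {x} → ¬ ABAdj n x x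
  ir {inj₁ i} p = p refl
  ir {inj₂ i} p = p refl

-- Suppose μ gives a_i and b_i the same colour c. For every j ≠ i the paths
-- a_j a_i b_i and b_j b_i a_i are induced, so a_j and b_j avoid c; with only
-- two colours they all share the other colour. Taking distinct j, k ≠ i (here
-- n ≥ 3 is used), b_j a_j a_k is then a monochromatic induced P3.
module Submission where

open import Defs using (ABGraph; InducedP3; IsSubcoloring)
open import Data.Nat using (ℕ; _≥_; s≤s)
open import Data.Fin using (Fin; zero; suc)
open import Data.Sum using (_⊎_; inj₁; inj₂)
open import Data.Product using (∃₂; _×_; _,_)
open import Relation.Nullary using (contradiction)
open import Relation.Binary.PropositionalEquality using (_≡_; _≢_; refl; trans; sym)

≢-same-Fin2 : {x y c : Fin 2} → x ≢ c → y ≢ c → x ≡ y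
≢-same-Fin2 {zero}     {zero}                 _   _   = refl
≢-same-Fin2 {suc zero} {suc zero}             _   _   = refl
≢-same-Fin2 {zero}     {suc zero} {zero}      x≢c _   = contradiction refl x≢c
≢-same-Fin2 {zero}     {suc zero} {suc zero}  _   y≢c = contradiction refl y≢c
≢-same-Fin2 {suc zero} {zero}     {zero}      _   y≢c = contradiction refl y≢c
≢-same-Fin2 {suc zero} {zero}     {suc zero}  x≢c _   = contradiction refl x≢c

two-others : ∀ {n} → n ≥ 3 → (i : Fin n) →
             ∃₂ λ j k → j ≢ i × k ≢ i × j ≢ k
two-others (s≤s (s≤s (s≤s _))) zero          = suc zero , suc (suc zero) , (λ ()) , (λ ()) , (λ ())
two-others (s≤s (s≤s (s≤s _))) (suc zero)    = zero , suc (suc zero) , (λ ()) , (λ ()) , (λ ())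
two-others (s≤s (s≤s (s≤s _))) (suc (suc _)) = zero , suc zero , (λ ()) , (λ ()) , (λ ())

module _ {n : ℕ} where

  aab-induced : {i j : Fin n} → j ≢ i → InducedP3 (ABGraph n) (inj₁ j) (inj₁ i) (inj₂ i)
  aab-induced j≢i = j≢i , refl , (λ ()) , j≢i

  bba-induced : {i j : Fin n} → j ≢ i → InducedP3 (ABGraph n) (inj₂ j) (inj₂ i) (inj₁ i)
  bba-induced j≢i = j≢i , refl , (λ ()) , j≢i

  baa-induced : {j k : Fin n} → j ≢ k → InducedP3 (ABGraph n) (inj₂ j) (inj₁ j) (inj₁ k)
  baa-induced j≢k = refl , j≢k , (λ ()) , j≢k

  module MonochromaticMatchingEdge
    {k : ℕ} {μ : Fin n ⊎ Fin n → Fin k} (sub : IsSubcoloring (ABGraph n) k μ)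
    {i : Fin n} (ai≡bi : μ (inj₁ i) ≡ μ (inj₂ i)) where

    a-avoids : {j : Fin n} → j ≢ i → μ (inj₁ j) ≢ μ (inj₁ i)
    a-avoids j≢i aj≡ai = sub _ _ _ aj≡ai ai≡bi (aab-induced j≢i)

    b-avoids : {j : Fin n} → j ≢ i → μ (inj₂ j) ≢ μ (inj₁ i)
    b-avoids j≢i bj≡ai = sub _ _ _ (trans bj≡ai ai≡bi) (sym ai≡bi) (bba-induced j≢i)

lemma9 : (n : ℕ) → n ≥ 3 → (μ : Fin n ⊎ Fin n → Fin 2) →
         IsSubcoloring (ABGraph n) 2 μ → ∀ (i : Fin n) → μ (inj₁ i) ≢ μ (inj₂ i)
lemma9 n n≥3 μ sub i ai≡bi with two-others n≥3 i
... | j , k , j≢i , k≢i , j≢k = sub _ _ _ bj≡aj aj≡ak (baa-induced j≢k)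
  where
  open MonochromaticMatchingEdge sub ai≡bi
  aj≡ak : μ (inj₁ j) ≡ μ (inj₁ k)
  aj≡ak = ≢-same-Fin2 (a-avoids j≢i) (a-avoids k≢i)
  bj≡aj : μ (inj₂ j) ≡ μ (inj₁ j)
  bj≡aj = ≢-same-Fin2 (b-avoids j≢i) (a-avoids j≢i)
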